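{- Work in $\mathrm{FOL}(=,\in)$ without Extensionality, in the theory with axioms: (Sheffer strokes) $\forall A,B\,\exists X\,\forall y\,(y\in X\Leftrightarrow \neg(y\in A\wedge y\in B))$; (Singletons) $\forall A\,\exists X\,\forall y\,(y\in X\Leftrightarrow y=A)$; (Set unions) $\forall A\,\exists X\,\forall y\,(y\in X\Leftrightarrow \exists k\,(k\in A\wedge y\in k))$; (Unordered relative products) $\forall R,S\,\exists X\,\forall y\,(y\in X\Leftrightarrow \exists a,b,c,r,s\,(\mathrm{pair}(y,a,c)\wedge r\in R\wedge s\in S\wedge \mathrm{pair}(r,a,b)\wedge \mathrm{pair}(s,b,c)))$; (Unordered intersection relation set) $\exists X\,\forall y\,(y\in X\Leftrightarrow \exists a,b,c\,(\mathrm{pair}(y,a,b)\wedge c\in a\wedge c\in b))$. Then for all $R,S$ the set $\{(a,c)\mid \exists b\,((a,b)\in R\wedge (b,c)\in S)\}$ exists, where $(\cdot,\cdot)$ denotes the Kuratowski ordered pair; i.e. $\forall R,S\,\exists X\,\forall y\,\big(y\in X\Leftrightarrow \exists a,b,c,r,s\,(\mathrm{kp}(y,a,c)\wedge r\in R\wedge \mathrm{kp}(r,a,b)\wedge s\in S\wedge \mathrm{kp}(s,b,c))\big)$.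
   Context: $\mathrm{pair}(x,a,b)$ abbreviates $\forall y\,(y\in x\Leftrightarrow y=a\vee y=b)$. The Kuratowski ordered pair $(a,b)=\{\{a\},\{a,b\}\}$ is expressed (without Extensionality) by $\mathrm{kp}(x,a,b)$: $\exists u,v\,(\mathrm{pair}(x,u,v)\wedge \mathrm{pair}(u,a,a)\wedge \mathrm{pair}(v,a,b))$. Extensionality is not assumed. -}

module Defs where

open import Data.Product using (Σ; _×_; ∃)
open import Data.Sum using (_⊎_)
open import Relation.Nullary using (¬_; Dec)
open import Relation.Binary.PropositionalEquality using (_≡_)
open import Function.Bundles using (_⇔_)

-- A structure for the language FOL(=,∈): a domain with a binary membership
-- relation; the logical symbol = is interpreted as true identity (≡).
-- No Extensionality is assumed.
record Structure : Set₁ where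
  field
    M   : Set
    _∈_ : M → M → Set

-- Classical metatheory: the semantics of FOL is two-valued.
LEM : Set₁
LEM = (P : Set) → Dec P

module _ (𝔐 : Structure) where
  open Structure 𝔐

  pair : M → M → M → Set
  pair x a b = ∀ y → (y ∈ x) ⇔ (y ≡ a ⊎ y ≡ b)

  kp : M → M → M → Set
  kp x a b = Σ M λ u → Σ M λ v → pair x u v × pair u a a × pair v a b

  ShefferAx : Set
  ShefferAx = ∀ A B → ∃ λ X → ∀ y → (y ∈ X) ⇔ (¬ (y ∈ A × y ∈ B))

  SingletonAx : Set
  SingletonAx = ∀ A → ∃ λ X → ∀ y → (y ∈ X) ⇔ (y ≡ A)

  UnionAx : Set
  UnionAx = ∀ A → ∃ λ X → ∀ y → (y ∈ X) ⇔ (∃ λ k → k ∈ A × y ∈ k)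

  UnorderedRelProdAx : Set
  UnorderedRelProdAx = ∀ R S → ∃ λ X → ∀ y → (y ∈ X) ⇔
    (Σ M λ a → Σ M λ b → Σ M λ c → Σ M λ r → Σ M λ s →
       pair y a c × r ∈ R × s ∈ S × pair r a b × pair s b c)

  UnorderedIntersectionRelAx : Set
  UnorderedIntersectionRelAx = ∃ λ X → ∀ y → (y ∈ X) ⇔
    (Σ M λ a → Σ M λ b → Σ M λ c → pair y a b × c ∈ a × c ∈ b)

  OrderedRelProd : Set
  OrderedRelProd = ∀ R S → ∃ λ X → ∀ y → (y ∈ X) ⇔
    (Σ M λ a → Σ M λ b → Σ M λ c → Σ M λ r → Σ M λ s →
       kp y a c × r ∈ R × kp r a b × s ∈ S × kp s b c)

module Submission where

-- A set of unordered pairs {x, z} describes a binary relation only up to symmetry, and the axioms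
-- close such sets under Boolean operations, unordered composition, fields and the "meets" relation.
-- Orientation is recovered by typing: if x always lies in a class C and z in a class disjoint from C,
-- the pair {x, z} can be read in only one direction. An object a has three pairwise disjoint kinds of
-- codes, {a}, 𝕍 ∖ {a} and {a} △ {∅}, and each class of codes as well as "codes the same object" is
-- definable. The Kuratowski pair (a, b) is traded for the edge {{a}, 𝕍 ∖ {b}}, the relative product
-- is formed on such typed edges by passing through the third kind of code, and the result is traded back.

open import Defs
open import Data.Empty using (⊥; ⊥-elim)
open import Data.Product using (Σ; ∃; _×_; _,_; proj₁; proj₂; uncurry)
open import Data.Sum using (_⊎_; inj₁; inj₂)
import Data.Sum as Sum
open import Data.Unit using (⊤; tt)
open import Function.Base using (flip)
open import Function.Bundles using (_⇔_; mk⇔; Equivalence)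
open import Level using (0ℓ)
open import Relation.Binary.Core using (Rel; _⇒_)
open import Relation.Binary.Definitions using (Symmetric)
open import Relation.Binary.Construct.Closure.Symmetric using (SymClosure; fwd; bwd; fold)
  renaming (symmetric to symClosure-sym; map to symClosure-map)
open import Relation.Binary.Construct.Intersection using () renaming (_∩_ to _∩ᴿ_)
open import Relation.Binary.Construct.Union using () renaming (_∪_ to _∪ᴿ_)
open import Relation.Binary.PropositionalEquality using (_≡_; _≢_; refl; sym; trans; subst; subst₂)
open import Relation.Nullary using (¬_; Dec; yes; no)
open import Relation.Nullary.Decidable using (decidable-stable)
open import Relation.Unary using (Pred; ∁; _∩_; _∪_; U; _⊆_) renaming (_⊥_ to Disjoint)
open import Relation.Unary.Properties using () renaming (⊥-sym to Disjoint-sym)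

module Construction
  (lem : LEM) (𝔐 : Structure)
  (sheffer : ShefferAx 𝔐) (singleton-ax : SingletonAx 𝔐) (union-ax : UnionAx 𝔐)
  (product-ax : UnorderedRelProdAx 𝔐) (meets-ax : UnorderedIntersectionRelAx 𝔐)
  (inhabitant : Structure.M 𝔐)
  where

  open Structure 𝔐
  open Equivalence

  stable : {P : Set} → ¬ ¬ P → P
  stable {P} = decidable-stable (lem P)

  _⨾_ : Rel M 0ℓ → Rel M 0ℓ → Rel M 0ℓ
  (A ⨾ B) x z = ∃ λ m → A x m × B m z

  _∉_ : M → M → Set
  p ∉ x = ¬ (p ∈ x)

  record SetOf (P : Pred M 0ℓ) : Set where
    constructor setOf
    field
      set : M
      ∈⇔  : ∀ y → y ∈ set ⇔ P y

    ∈⁺ : ∀ {y} → P y → y ∈ set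
    ∈⁺ = from (∈⇔ _)

    ∈⁻ : ∀ {y} → y ∈ set → P y
    ∈⁻ = to (∈⇔ _)

  open SetOf public

  SetOf-cong : {P Q : Pred M 0ℓ} → SetOf P → P ⊆ Q → Q ⊆ P → SetOf Q
  SetOf-cong S P⊆Q Q⊆P = setOf (set S) (λ y → mk⇔ (λ y∈S → P⊆Q (∈⁻ S y∈S)) (λ q → ∈⁺ S (Q⊆P q)))

  -- Boolean combinations of sets

  members : (x : M) → SetOf (_∈ x)
  members x = setOf x (λ y → mk⇔ (λ h → h) (λ h → h))

  nand : {P Q : Pred M 0ℓ} → SetOf P → SetOf Q → SetOf (∁ (P ∩ Q))
  nand A B = SetOf-cong (uncurry setOf (sheffer (set A) (set B)))
    (λ ¬AB (p , q) → ¬AB (∈⁺ A p , ∈⁺ B q))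
    (λ ¬PQ (a , b) → ¬PQ (∈⁻ A a , ∈⁻ B b))

  complement : {P : Pred M 0ℓ} → SetOf P → SetOf (∁ P)
  complement A = SetOf-cong (nand A A) (λ ¬PP p → ¬PP (p , p)) (λ ¬P (p , _) → ¬P p)

  intersection : {P Q : Pred M 0ℓ} → SetOf P → SetOf Q → SetOf (P ∩ Q)
  intersection A B = SetOf-cong (complement (nand A B)) stable (λ pq ¬pq → ¬pq pq)

  union : {P Q : Pred M 0ℓ} → SetOf P → SetOf Q → SetOf (P ∪ Q)
  union {P} {Q} A B = SetOf-cong (nand (complement A) (complement B)) classical intuitionistic
    where
    classical : ∀ {y} → ¬ (¬ P y × ¬ Q y) → P y ⊎ Q y
    classical {y} ¬both with lem (P y) | lem (Q y)
    ... | yes p | _     = inj₁ p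
    ... | no _  | yes q = inj₂ q
    ... | no ¬p | no ¬q = ⊥-elim (¬both (¬p , ¬q))
    intuitionistic : ∀ {y} → P y ⊎ Q y → ¬ (¬ P y × ¬ Q y)
    intuitionistic (inj₁ p) (¬p , _) = ¬p p
    intuitionistic (inj₂ q) (_ , ¬q) = ¬q q

  universe : SetOf U
  universe = SetOf-cong (nand (members inhabitant) (complement (members inhabitant)))
    (λ _ → tt) (λ _ (y∈o , y∉o) → y∉o y∈o)

  singleton : (a : M) → SetOf (_≡ a)
  singleton a = uncurry setOf (singleton-ax a)

  ∅ : M
  ∅ = set (complement universe)

  𝕍 : M
  𝕍 = set universe

  ∉∅ : ∀ p → p ∉ ∅
  ∉∅ p p∈∅ = ∈⁻ (complement universe) p∈∅ tt

  ∈𝕍 : ∀ p → p ∈ 𝕍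
  ∈𝕍 p = ∈⁺ universe tt

  ∅≢𝕍 : ∅ ≢ 𝕍
  ∅≢𝕍 ∅≡𝕍 = ∉∅ ∅ (subst (∅ ∈_) (sym ∅≡𝕍) (∈𝕍 ∅))

  unorderedPair : (a b : M) → SetOf (λ y → y ≡ a ⊎ y ≡ b)
  unorderedPair a b = union (singleton a) (singleton b)

  bigUnion : {P : Pred M 0ℓ} → SetOf P → SetOf (λ y → ∃ λ k → P k × y ∈ k)
  bigUnion A = SetOf-cong (uncurry setOf (union-ax (set A)))
    (λ (k , k∈A , y∈k) → k , ∈⁻ A k∈A , y∈k)
    (λ (k , Pk , y∈k) → k , ∈⁺ A Pk , y∈k)

  IsPair : M → M → M → Set
  IsPair = pair 𝔐

  pair-sym : ∀ {e x z} → IsPair e x z → IsPair e z x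
  pair-sym e≈xz y = mk⇔ (λ y∈e → Sum.swap (to (e≈xz y) y∈e)) (λ h → from (e≈xz y) (Sum.swap h))

  pair-∈ˡ : ∀ {e x z} → IsPair e x z → x ∈ e
  pair-∈ˡ e≈xz = from (e≈xz _) (inj₁ refl)

  pair-∈ʳ : ∀ {e x z} → IsPair e x z → z ∈ e
  pair-∈ʳ e≈xz = from (e≈xz _) (inj₂ refl)

  pair-∈⁻ : ∀ {e x z y} → IsPair e x z → y ∈ e → y ≡ x ⊎ y ≡ z
  pair-∈⁻ e≈xz y∈e = to (e≈xz _) y∈e

  pair-exists : (x z : M) → ∃ λ e → IsPair e x z
  pair-exists x z = set (unorderedPair x z) , ∈⇔ (unorderedPair x z)

  pair-injective : ∀ {e x z x′ z′} → IsPair e x z → IsPair e x′ z′ →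
                   (x′ ≡ x × z′ ≡ z) ⊎ (x′ ≡ z × z′ ≡ x)
  pair-injective e≈xz e≈x′z′
    with pair-∈⁻ e≈xz (pair-∈ˡ e≈x′z′) | pair-∈⁻ e≈xz (pair-∈ʳ e≈x′z′)
  ... | inj₁ x′≡x | inj₂ z′≡z = inj₁ (x′≡x , z′≡z)
  ... | inj₂ x′≡z | inj₁ z′≡x = inj₂ (x′≡z , z′≡x)
  ... | inj₁ x′≡x | inj₁ z′≡x with pair-∈⁻ e≈x′z′ (pair-∈ʳ e≈xz)
  ...   | inj₁ z≡x′ = inj₁ (x′≡x , trans z′≡x (trans (sym x′≡x) (sym z≡x′)))
  ...   | inj₂ z≡z′ = inj₁ (x′≡x , sym z≡z′)
  pair-injective e≈xz e≈x′z′ | inj₂ x′≡z | inj₂ z′≡z with pair-∈⁻ e≈x′z′ (pair-∈ˡ e≈xz)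
  ...   | inj₁ x≡x′ = inj₁ (sym x≡x′ , z′≡z)
  ...   | inj₂ x≡z′ = inj₁ (trans x′≡z (trans (sym z′≡z) (sym x≡z′)) , z′≡z)

  IsSingleton : Rel M 0ℓ
  IsSingleton x a = a ∈ x × (∀ {p} → p ∈ x → p ≡ a)

  Singleton : Pred M 0ℓ
  Singleton x = ∃ (IsSingleton x)

  singleton-isSingleton : (a : M) → IsSingleton (set (singleton a)) a
  singleton-isSingleton a = ∈⁺ (singleton a) refl , ∈⁻ (singleton a)

  pair-isSingleton : ∀ {u a} → IsPair u a a → IsSingleton u a
  pair-isSingleton u≈aa = pair-∈ˡ u≈aa , λ p∈u → Sum.reduce (pair-∈⁻ u≈aa p∈u)

  isSingleton-pair : ∀ {u a} → IsSingleton u a → IsPair u a a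
  isSingleton-pair (a∈u , only-a) y =
    mk⇔ (λ y∈u → inj₁ (only-a y∈u)) (λ { (inj₁ refl) → a∈u ; (inj₂ refl) → a∈u })

  -- Relations, as sets of unordered pairs

  Edge : Rel M 0ℓ → Pred M 0ℓ
  Edge A e = ∃ λ x → ∃ λ z → IsPair e x z × A x z

  -- Membership of an edge {x, z} in a RelOf A only tells SymClosure A x z. Operations carry the suffix
  -- ᴿ for arbitrary, ˢ for symmetric, ᵗ for disjointly typed relations, and ᶜ for relations between codes.
  RelOf : Rel M 0ℓ → Set
  RelOf A = SetOf (Edge A)

  Links : M → Rel M 0ℓ
  Links X x z = ∃ λ e → e ∈ X × IsPair e x z

  edge-at : ∀ {A e x z} → IsPair e x z → Edge A e → SymClosure A x z
  edge-at e≈xz (_ , _ , e≈x′z′ , a) with pair-injective e≈xz e≈x′z′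
  ... | inj₁ (refl , refl) = fwd a
  ... | inj₂ (refl , refl) = bwd a

  edge-of : ∀ {A e x z} → IsPair e x z → SymClosure A x z → Edge A e
  edge-of e≈xz (fwd a) = _ , _ , e≈xz , a
  edge-of e≈xz (bwd a) = _ , _ , pair-sym e≈xz , a

  links⁻ : ∀ {A} (R : RelOf A) → Links (set R) ⇒ SymClosure A
  links⁻ R (e , e∈R , e≈xz) = edge-at e≈xz (∈⁻ R e∈R)

  links⁺ : ∀ {A} (R : RelOf A) → SymClosure A ⇒ Links (set R)
  links⁺ R {x} {z} a = let (e , e≈xz) = pair-exists x z in e , ∈⁺ R (edge-of e≈xz a) , e≈xz

  RelOf-cong : ∀ {A B} → RelOf A → A ⇒ SymClosure B → B ⇒ SymClosure A → RelOf B
  RelOf-cong R A⇒B B⇒A = SetOf-cong R (λ (_ , _ , e≈xz , a) → edge-of e≈xz (A⇒B a))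
                                      (λ (_ , _ , e≈xz , b) → edge-of e≈xz (B⇒A b))

  symClosure-elim : {A : Rel M 0ℓ} → Symmetric A → SymClosure A ⇒ A
  symClosure-elim A-sym = fold A-sym (λ a → a)

  compositionOf : (X Y : M) → RelOf (Links X ⨾ Links Y)
  compositionOf X Y = SetOf-cong (uncurry setOf (product-ax X Y))
    (λ (a , b , c , r , s , y≈ac , r∈X , s∈Y , r≈ab , s≈bc) →
       a , c , y≈ac , b , (r , r∈X , r≈ab) , (s , s∈Y , s≈bc))
    (λ (a , c , y≈ac , b , (r , r∈X , r≈ab) , (s , s∈Y , s≈bc)) →
       a , b , c , r , s , y≈ac , r∈X , s∈Y , r≈ab , s≈bc)

  composeᴿ : ∀ {A B} → RelOf A → RelOf B → RelOf (SymClosure A ⨾ SymClosure B)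
  composeᴿ RA RB = RelOf-cong (compositionOf (set RA) (set RB))
    (λ (m , xm , mz) → fwd (m , links⁻ RA xm , links⁻ RB mz))
    (λ (m , xm , mz) → fwd (m , links⁺ RA xm , links⁺ RB mz))

  intersectᴿ : ∀ {A B} → RelOf A → RelOf B → RelOf (SymClosure A ∩ᴿ SymClosure B)
  intersectᴿ RA RB = SetOf-cong (intersection RA RB)
    (λ ((x , z , e≈xz , a) , b) → x , z , e≈xz , fwd a , edge-at e≈xz b)
    (λ (_ , _ , e≈xz , a , b) → edge-of e≈xz a , edge-of e≈xz b)

  uniteᴿ : ∀ {A B} → RelOf A → RelOf B → RelOf (A ∪ᴿ B)
  uniteᴿ RA RB = SetOf-cong (union RA RB)
    (λ { (inj₁ (x , z , e≈xz , a)) → x , z , e≈xz , inj₁ a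
       ; (inj₂ (x , z , e≈xz , b)) → x , z , e≈xz , inj₂ b })
    (λ { (x , z , e≈xz , inj₁ a) → inj₁ (x , z , e≈xz , a)
       ; (x , z , e≈xz , inj₂ b) → inj₂ (x , z , e≈xz , b) })

  fieldOf : ∀ {A} → RelOf A → SetOf (λ x → ∃ (SymClosure A x))
  fieldOf R = SetOf-cong (bigUnion R) sound complete
    where
    sound : ∀ {y} → ∃ (λ k → Edge _ k × y ∈ k) → ∃ (SymClosure _ y)
    sound (_ , (x , z , k≈xz , a) , y∈k) with pair-∈⁻ k≈xz y∈k
    ... | inj₁ refl = z , fwd a
    ... | inj₂ refl = x , bwd a
    complete : ∀ {y} → ∃ (SymClosure _ y) → ∃ (λ k → Edge _ k × y ∈ k)
    complete {y} (z , a) = let (e , e≈yz) = pair-exists y z in e , edge-of e≈yz a , pair-∈ˡ e≈yz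

  allPairs : RelOf (λ _ _ → ⊤)
  allPairs = RelOf-cong (compositionOf (set universe) (set universe))
    (λ _ → fwd tt) (λ {x} {z} _ → fwd (x , linked x x , linked x z))
    where
    linked : ∀ x z → Links (set universe) x z
    linked x z = let (e , e≈xz) = pair-exists x z in e , ∈⁺ universe tt , e≈xz

  complementᴿ : ∀ {A} → RelOf A → RelOf (λ x z → ¬ SymClosure A x z)
  complementᴿ R = SetOf-cong (intersection allPairs (complement R))
    (λ ((x , z , e≈xz , _) , ¬edge) → x , z , e≈xz , λ a → ¬edge (edge-of e≈xz a))
    (λ (x , z , e≈xz , ¬a) → (x , z , e≈xz , tt) , λ edge → ¬a (edge-at e≈xz edge))

  composeˢ : {A B : Rel M 0ℓ} → Symmetric A → Symmetric B → RelOf A → RelOf B → RelOf (A ⨾ B)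
  composeˢ A-sym B-sym RA RB = RelOf-cong (composeᴿ RA RB)
    (λ (m , xm , mz) → fwd (m , symClosure-elim A-sym xm , symClosure-elim B-sym mz))
    (λ (m , xm , mz) → fwd (m , fwd xm , fwd mz))

  intersectˢ : {A B : Rel M 0ℓ} → Symmetric A → Symmetric B → RelOf A → RelOf B → RelOf (A ∩ᴿ B)
  intersectˢ A-sym B-sym RA RB = RelOf-cong (intersectᴿ RA RB)
    (λ (a , b) → fwd (symClosure-elim A-sym a , symClosure-elim B-sym b))
    (λ (a , b) → fwd (fwd a , fwd b))

  complementˢ : {A : Rel M 0ℓ} → Symmetric A → RelOf A → RelOf (λ x z → ¬ A x z)
  complementˢ A-sym R = RelOf-cong (complementᴿ R)
    (λ ¬a → fwd (λ a → ¬a (fwd a)))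
    (λ ¬a → fwd (λ a → ¬a (symClosure-elim A-sym a)))

  fieldˢ : {A : Rel M 0ℓ} → Symmetric A → RelOf A → SetOf (λ x → ∃ (A x))
  fieldˢ A-sym R = SetOf-cong (fieldOf R)
    (λ (z , a) → z , symClosure-elim A-sym a) (λ (z , a) → z , fwd a)

  Meets : Rel M 0ℓ
  Meets x z = ∃ λ c → c ∈ x × c ∈ z

  Misses : Rel M 0ℓ
  Misses x z = ¬ Meets x z

  meets-sym : Symmetric Meets
  meets-sym (c , c∈x , c∈z) = c , c∈z , c∈x

  misses-sym : Symmetric Misses
  misses-sym ¬xz zx = ¬xz (meets-sym zx)

  meetsᴿ : RelOf Meets
  meetsᴿ = SetOf-cong (uncurry setOf meets-ax)
    (λ (a , b , c , e≈ab , c∈a , c∈b) → a , b , e≈ab , c , c∈a , c∈b)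
    (λ (a , b , e≈ab , c , c∈a , c∈b) → a , b , c , e≈ab , c∈a , c∈b)

  missesᴿ : RelOf Misses
  missesᴿ = complementˢ meets-sym meetsᴿ

  -- The single edge {A, A} singles out A, so composing it with meets links x to A iff x meets A.
  overlapping : {P : Pred M 0ℓ} → SetOf P → SetOf (λ x → ∃ λ p → p ∈ x × P p)
  overlapping {P} A = SetOf-cong (fieldOf (compositionOf (set meetsᴿ) loop)) sound complete
    where
    loop : M
    loop = set (singleton (set (singleton (set A))))
    at-A : ∀ {b c} → Links loop b c → b ≡ set A × c ≡ set A
    at-A (e , e∈ , e≈bc) with ∈⁻ (singleton _) e∈
    ... | refl = ∈⁻ (singleton _) (pair-∈ˡ e≈bc) , ∈⁻ (singleton _) (pair-∈ʳ e≈bc)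
    meets : ∀ {x z} → Links (set meetsᴿ) x z → Meets x z
    meets l = symClosure-elim meets-sym (links⁻ meetsᴿ l)
    Path : Rel M 0ℓ
    Path = Links (set meetsᴿ) ⨾ Links loop
    sound : ∀ {x} → ∃ (SymClosure Path x) → ∃ λ p → p ∈ x × P p
    sound (_ , fwd (_ , x-b , b-z)) with at-A b-z
    ... | refl , _ = let (p , p∈x , p∈A) = meets x-b in p , p∈x , ∈⁻ A p∈A
    sound (_ , bwd (_ , z-b , b-x)) with at-A b-x
    ... | refl , refl = let (p , _ , p∈A) = meets z-b in p , p∈A , ∈⁻ A p∈A
    complete : ∀ {x} → (∃ λ p → p ∈ x × P p) → ∃ (SymClosure Path x)
    complete (p , p∈x , Pp) = set A , fwd (set A , links⁺ meetsᴿ (fwd (p , p∈x , ∈⁺ A Pp)) ,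
                                           (_ , ∈⁺ (singleton _) refl , isSingleton-pair (singleton-isSingleton (set A))))

  contained : {P : Pred M 0ℓ} → SetOf P → SetOf (λ x → ∀ {p} → p ∈ x → P p)
  contained A = SetOf-cong (complement (overlapping (complement A)))
    (λ ¬outside p∈x → stable (λ ¬Pp → ¬outside (_ , p∈x , ¬Pp)))
    (λ inside (_ , p∈x , ¬Pp) → ¬Pp (inside p∈x))

  rectangle : {C D : Pred M 0ℓ} → SetOf C → SetOf D → RelOf (λ x z → C x × D z)
  rectangle {C} {D} SC SD = SetOf-cong
    (intersection allPairs (intersection (contained (union SC SD)) (intersection (overlapping SC) (overlapping SD))))
    sound complete
    where
    sound : ∀ {e} → Edge (λ _ _ → ⊤) e × (∀ {p} → p ∈ e → C p ⊎ D p) ×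
              (∃ λ p → p ∈ e × C p) × (∃ λ q → q ∈ e × D q) → Edge (λ x z → C x × D z) e
    sound ((x , z , e≈xz , _) , e⊆C∪D , (_ , p∈e , Cp) , (_ , q∈e , Dq))
      with pair-∈⁻ e≈xz p∈e | pair-∈⁻ e≈xz q∈e
    ... | inj₁ refl | inj₂ refl = x , z , e≈xz , Cp , Dq
    ... | inj₂ refl | inj₁ refl = z , x , pair-sym e≈xz , Cp , Dq
    ... | inj₁ refl | inj₁ refl with e⊆C∪D (pair-∈ʳ e≈xz)
    ...   | inj₁ Cz = z , x , pair-sym e≈xz , Cz , Dq
    ...   | inj₂ Dz = x , z , e≈xz , Cp , Dz
    sound ((x , z , e≈xz , _) , e⊆C∪D , (_ , p∈e , Cp) , (_ , q∈e , Dq)) | inj₂ refl | inj₂ refl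
      with e⊆C∪D (pair-∈ˡ e≈xz)
    ...   | inj₁ Cx = x , z , e≈xz , Cx , Dq
    ...   | inj₂ Dx = z , x , pair-sym e≈xz , Cp , Dx
    complete : ∀ {e} → Edge (λ x z → C x × D z) e → Edge (λ _ _ → ⊤) e × (∀ {p} → p ∈ e → C p ⊎ D p) ×
                 (∃ λ p → p ∈ e × C p) × (∃ λ q → q ∈ e × D q)
    complete (x , z , e≈xz , Cx , Dz) =
      (x , z , e≈xz , tt) , members-in , (x , pair-∈ˡ e≈xz , Cx) , (z , pair-∈ʳ e≈xz , Dz)
      where
      members-in : ∀ {p} → p ∈ _ → C p ⊎ D p
      members-in p∈e with pair-∈⁻ e≈xz p∈e
      ... | inj₁ refl = inj₁ Cx
      ... | inj₂ refl = inj₂ Dz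

  Restrict : Pred M 0ℓ → Pred M 0ℓ → Rel M 0ℓ → Rel M 0ℓ
  Restrict C D Q x z = C x × D z × Q x z

  restrict : {C D : Pred M 0ℓ} {Q : Rel M 0ℓ} → SetOf C → SetOf D → Symmetric Q → RelOf Q →
             RelOf (Restrict C D Q)
  restrict SC SD Q-sym RQ = RelOf-cong (intersectᴿ (rectangle SC SD) RQ)
    (λ { (fwd (c , d) , q) → fwd (c , d , symClosure-elim Q-sym q)
       ; (bwd (c , d) , q) → bwd (c , d , Q-sym (symClosure-elim Q-sym q)) })
    (λ (c , d , q) → fwd (fwd (c , d) , fwd q))

  -- Relations between disjoint classes remember their orientation

  _⊆_⊗_ : Rel M 0ℓ → Pred M 0ℓ → Pred M 0ℓ → Set
  A ⊆ C ⊗ D = ∀ {x z} → A x z → C x × D z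

  restrict-⊆ : {C D : Pred M 0ℓ} {Q : Rel M 0ℓ} → Restrict C D Q ⊆ C ⊗ D
  restrict-⊆ (c , d , _) = c , d

  oriented : {A : Rel M 0ℓ} {C D : Pred M 0ℓ} → Disjoint C D → A ⊆ C ⊗ D →
             ∀ {x z} → C x → SymClosure A x z → A x z
  oriented C⊥D A⊆ Cx (fwd a) = a
  oriented C⊥D A⊆ Cx (bwd a) = ⊥-elim (C⊥D (Cx , proj₂ (A⊆ a)))

  composeᵗ : {A B : Rel M 0ℓ} {C E D : Pred M 0ℓ} → Disjoint C E → Disjoint E D → Disjoint C D →
             A ⊆ C ⊗ E → B ⊆ E ⊗ D → RelOf A → RelOf B → RelOf (A ⨾ B)
  composeᵗ {A} {B} C⊥E E⊥D C⊥D A⊆ B⊆ RA RB =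
    RelOf-cong (composeᴿ RA RB) sound (λ (m , a , b) → fwd (m , fwd a , fwd b))
    where
    sound : (SymClosure A ⨾ SymClosure B) ⇒ SymClosure (A ⨾ B)
    sound (m , fwd a , mz)    = fwd (m , a , oriented E⊥D B⊆ (proj₂ (A⊆ a)) mz)
    sound (m , bwd a , fwd b) = ⊥-elim (C⊥E (proj₁ (A⊆ a) , proj₁ (B⊆ b)))
    sound (m , bwd a , bwd b) = ⊥-elim (C⊥D (proj₁ (A⊆ a) , proj₂ (B⊆ b)))

  intersectᵗ : {A B : Rel M 0ℓ} {C D : Pred M 0ℓ} → Disjoint C D → A ⊆ C ⊗ D → B ⊆ C ⊗ D →
               RelOf A → RelOf B → RelOf (A ∩ᴿ B)
  intersectᵗ {A} {B} C⊥D A⊆ B⊆ RA RB =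
    RelOf-cong (intersectᴿ RA RB) sound (λ (a , b) → fwd (fwd a , fwd b))
    where
    sound : (SymClosure A ∩ᴿ SymClosure B) ⇒ SymClosure (A ∩ᴿ B)
    sound (fwd a , b)     = fwd (a , oriented C⊥D B⊆ (proj₁ (A⊆ a)) b)
    sound (bwd a , bwd b) = bwd (a , b)
    sound (bwd a , fwd b) = ⊥-elim (C⊥D (proj₁ (B⊆ b) , proj₂ (A⊆ a)))

  domainᵗ : {A : Rel M 0ℓ} {C D : Pred M 0ℓ} → Disjoint C D → A ⊆ C ⊗ D → SetOf C → RelOf A →
            SetOf (λ x → ∃ (A x))
  domainᵗ C⊥D A⊆ SC R = SetOf-cong (intersection (fieldOf R) SC)
    (λ ((z , a) , Cx) → z , oriented C⊥D A⊆ Cx a)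
    (λ (z , a) → (z , fwd a) , proj₁ (A⊆ a))

  flipᴿ : {A : Rel M 0ℓ} → RelOf A → RelOf (flip A)
  flipᴿ R = RelOf-cong R bwd bwd

  -- Definable classes

  Nonempty : Pred M 0ℓ
  Nonempty x = ∃ (_∈ x)

  Full : Pred M 0ℓ
  Full x = ∀ p → p ∈ x

  _⊑_ : Rel M 0ℓ
  x ⊑ z = ∀ {p} → p ∈ x → p ∈ z

  _⋢_ : Rel M 0ℓ
  x ⋢ z = ∃ λ p → p ∈ x × p ∉ z

  Coextensive : Rel M 0ℓ
  Coextensive x z = x ⊑ z × z ⊑ x

  Outside : Rel M 0ℓ
  Outside x z = ∃ λ p → p ∉ x × p ∉ z

  Covers : Rel M 0ℓ
  Covers x z = ¬ Outside x z

  Plural : Pred M 0ℓ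
  Plural x = ∃ λ p → ∃ λ q → p ∈ x × q ∈ x × p ≢ q

  ⋢-witness : ∀ {x z} → ¬ x ⊑ z → x ⋢ z
  ⋢-witness x⋢z = stable (λ ¬witness → x⋢z (λ {p} p∈x → stable (λ p∉z → ¬witness (p , p∈x , p∉z))))

  nonfull-witness : ∀ {x} → ¬ Full x → ∃ (_∉ x)
  nonfull-witness ¬full = stable (λ ¬witness → ¬full (λ p → stable (λ p∉x → ¬witness (p , p∉x))))

  singleton-misses : ∀ {p x} → p ∉ x → Misses (set (singleton p)) x
  singleton-misses p∉x (c , c∈sp , c∈x) = p∉x (subst (_∈ _) (∈⁻ (singleton _) c∈sp) c∈x)

  nonempty : SetOf Nonempty
  nonempty = SetOf-cong (overlapping universe) (λ (p , p∈x , _) → p , p∈x) (λ (p , p∈x) → p , p∈x , tt)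

  ⋢ᴿ : RelOf _⋢_
  ⋢ᴿ = RelOf-cong (composeˢ meets-sym misses-sym meetsᴿ missesᴿ)
    (λ (m , (p , p∈x , p∈m) , m-misses-z) → fwd (p , p∈x , λ p∈z → m-misses-z (p , p∈m , p∈z)))
    (λ (p , p∈x , p∉z) → fwd (set (singleton p) , (p , p∈x , ∈⁺ (singleton p) refl) , singleton-misses p∉z))

  coextensive-sym : Symmetric Coextensive
  coextensive-sym (x⊑z , z⊑x) = z⊑x , x⊑z

  coextensiveᴿ : RelOf Coextensive
  coextensiveᴿ = RelOf-cong (complementᴿ ⋢ᴿ)
    (λ ¬⋢ → fwd ( (λ {p} p∈x → stable (λ p∉z → ¬⋢ (fwd (p , p∈x , p∉z))))
                , (λ {p} p∈z → stable (λ p∉x → ¬⋢ (bwd (p , p∈z , p∉x))))))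
    (λ (x⊑z , z⊑x) → fwd λ { (fwd (_ , p∈x , p∉z)) → p∉z (x⊑z p∈x)
                           ; (bwd (_ , p∈z , p∉x)) → p∉x (z⊑x p∈z) })

  full : SetOf Full
  full = SetOf-cong (fieldOf (restrict universe (singleton 𝕍) coextensive-sym coextensiveᴿ))
    (λ { (_ , fwd (_ , refl , _ , 𝕍⊑x)) p → 𝕍⊑x (∈𝕍 p)
       ; (_ , bwd (_ , refl , _)) p → ∈𝕍 p })
    (λ x-full → 𝕍 , fwd (tt , refl , (λ {p} _ → ∈𝕍 p) , (λ {p} _ → x-full p)))

  outside-sym : Symmetric Outside
  outside-sym (p , p∉x , p∉z) = p , p∉z , p∉x

  covers-sym : Symmetric Covers
  covers-sym ¬xz zx = ¬xz (outside-sym zx)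

  -- p lies outside x and z iff the nonempty {p} misses both; an empty x is handled separately.
  outsideᴿ : RelOf Outside
  outsideᴿ = RelOf-cong (uniteᴿ (composeˢ apart-sym apart-sym apartᴿ apartᴿ)
                                (rectangle (complement nonempty) (complement full)))
    sound complete
    where
    Apart : Rel M 0ℓ
    Apart = Restrict Nonempty Nonempty Misses
    apart-sym : Symmetric Apart
    apart-sym (x-ne , z-ne , x-z) = z-ne , x-ne , misses-sym x-z
    apartᴿ : RelOf Apart
    apartᴿ = restrict nonempty nonempty misses-sym missesᴿ
    sound : (Apart ⨾ Apart) ∪ᴿ (λ x z → ¬ Nonempty x × ¬ Full z) ⇒ SymClosure Outside
    sound (inj₁ (m , (_ , (p , p∈m) , x-m) , (_ , _ , m-z))) =
      fwd (p , (λ p∈x → x-m (p , p∈x , p∈m)) , (λ p∈z → m-z (p , p∈m , p∈z)))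
    sound (inj₂ (x-empty , z-nonfull)) =
      let (p , p∉z) = nonfull-witness z-nonfull in fwd (p , (λ p∈x → x-empty (p , p∈x)) , p∉z)
    complete : Outside ⇒ SymClosure ((Apart ⨾ Apart) ∪ᴿ (λ x z → ¬ Nonempty x × ¬ Full z))
    complete {x} {z} (p , p∉x , p∉z) with lem (Nonempty x) | lem (Nonempty z)
    ... | no x-empty | _          = fwd (inj₂ (x-empty , λ z-full → p∉z (z-full p)))
    ... | yes _      | no z-empty = bwd (inj₂ (z-empty , λ x-full → p∉x (x-full p)))
    ... | yes x-ne   | yes z-ne   =
      fwd (inj₁ (set (singleton p) , (x-ne , p∈sp , misses-sym (singleton-misses p∉x))
                                   , (p∈sp , z-ne , singleton-misses p∉z)))
      where p∈sp = p , ∈⁺ (singleton p) refl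

  coversᴿ : RelOf Covers
  coversᴿ = complementˢ outside-sym outsideᴿ

  -- x ⊑ z iff x misses some m covering z (e.g. the complement of z); read unordered, this is comparability.
  ⊑ᴿ : RelOf _⊑_
  ⊑ᴿ = RelOf-cong (composeˢ misses-sym covers-sym missesᴿ coversᴿ)
    (λ (m , x-m , m-z) → fwd (λ {p} p∈x →
       stable (λ p∉z → m-z (p , (λ p∈m → x-m (p , p∈x , p∈m)) , p∉z))))
    (λ {x} {z} x⊑z → fwd (set (complement (members z))
      , (λ (c , c∈x , c∈z̄) → ∈⁻ (complement (members z)) c∈z̄ (x⊑z c∈x))
      , (λ (p , p∉z̄ , p∉z) → p∉z̄ (∈⁺ (complement (members z)) p∉z))))

  -- Witness: when p, q ∈ x and t ∉ x, the set {p, t} meets x and is incomparable with it.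
  pluralNonfull : SetOf (λ x → Plural x × ¬ Full x)
  pluralNonfull = SetOf-cong (fieldˢ crossing-sym (intersectˢ meets-sym incomparable-sym meetsᴿ (complementᴿ ⊑ᴿ)))
    sound complete
    where
    incomparable-sym : Symmetric (λ x z → ¬ SymClosure _⊑_ x z)
    incomparable-sym ¬xz zx = ¬xz (symClosure-sym _ zx)
    crossing-sym : Symmetric (Meets ∩ᴿ (λ x z → ¬ SymClosure _⊑_ x z))
    crossing-sym (m , i) = meets-sym m , incomparable-sym i
    sound : ∀ {x} → ∃ ((Meets ∩ᴿ (λ x z → ¬ SymClosure _⊑_ x z)) x) → Plural x × ¬ Full x
    sound {x} (z , (c , c∈x , c∈z) , ¬cmp) =
      let (q , q∈x , q∉z) = ⋢-witness (λ x⊑z → ¬cmp (fwd x⊑z))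
          (t , t∈z , t∉x) = ⋢-witness (λ z⊑x → ¬cmp (bwd z⊑x))
      in (c , q , c∈x , q∈x , λ c≡q → q∉z (subst (_∈ z) c≡q c∈z)) , λ x-full → t∉x (x-full t)
    complete : ∀ {x} → Plural x × ¬ Full x → ∃ ((Meets ∩ᴿ (λ x z → ¬ SymClosure _⊑_ x z)) x)
    complete ((p , q , p∈x , q∈x , p≢q) , x-nonfull) = set pt , (p , p∈x , ∈⁺ pt (inj₁ refl)) , incomparable
      where
      t = proj₁ (nonfull-witness x-nonfull)
      t∉x = proj₂ (nonfull-witness x-nonfull)
      pt = unorderedPair p t
      incomparable : ¬ SymClosure _⊑_ _ (set pt)
      incomparable (fwd x⊑pt) with ∈⁻ pt (x⊑pt q∈x)
      ... | inj₁ q≡p = p≢q (sym q≡p)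
      ... | inj₂ q≡t = t∉x (subst (_∈ _) q≡t q∈x)
      incomparable (bwd pt⊑x) = t∉x (pt⊑x (∈⁺ pt (inj₂ refl)))

  plural : SetOf Plural
  plural = SetOf-cong (union pluralNonfull full)
    (λ { (inj₁ (x-plural , _)) → x-plural ; (inj₂ x-full) → ∅ , 𝕍 , x-full _ , x-full _ , ∅≢𝕍 })
    (λ {x} x-plural → case-full x x-plural (lem (Full x)))
    where
    case-full : ∀ x → Plural x → Dec (Full x) → (Plural x × ¬ Full x) ⊎ Full x
    case-full x x-plural (yes x-full) = inj₂ x-full
    case-full x x-plural (no x-nonfull) = inj₁ (x-plural , x-nonfull)

  singleton⊥plural : Disjoint Singleton Plural
  singleton⊥plural ((_ , _ , only-a) , (_ , _ , p∈x , q∈x , p≢q)) = p≢q (trans (only-a p∈x) (sym (only-a q∈x)))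

  singletons : SetOf Singleton
  singletons = SetOf-cong (intersection nonempty (complement plural))
    (λ ((a , a∈x) , ¬plural) → a , a∈x , λ {p} p∈x → stable (λ p≢a → ¬plural (p , a , p∈x , a∈x , p≢a)))
    (λ (a , x≈a) → (a , proj₁ x≈a) , λ x-plural → singleton⊥plural ((a , x≈a) , x-plural))

  -- Three ways of coding an object a: by {a}, by its complement, and by {a} △ {∅}

  IsCosingleton : Rel M 0ℓ
  IsCosingleton w c = c ∉ w × (∀ {p} → p ≢ c → p ∈ w)

  Cosingleton : Pred M 0ℓ
  Cosingleton w = ∃ (IsCosingleton w)

  infixr 1 _⊻_

  _⊻_ : Set → Set → Set
  A ⊻ B = (A × ¬ B) ⊎ (¬ A × B)

  IsToggle : Rel M 0ℓ
  IsToggle m b = ∀ p → p ∈ m ⇔ (p ≡ b ⊻ p ≡ ∅)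

  Toggle : Pred M 0ℓ
  Toggle m = ∃ (IsToggle m)

  Small : Pred M 0ℓ
  Small w = ∃ λ q₁ → ∃ λ q₂ → ∀ {p} → p ∈ w → p ≡ q₁ ⊎ p ≡ q₂

  singleton-exists : ∀ a → ∃ λ x → IsSingleton x a
  singleton-exists a = set (singleton a) , singleton-isSingleton a

  cosingleton-exists : ∀ c → ∃ λ w → IsCosingleton w c
  cosingleton-exists c = set w̄ , (λ c∈w̄ → ∈⁻ w̄ c∈w̄ refl) , (λ p≢c → ∈⁺ w̄ p≢c)
    where w̄ = complement (singleton c)

  toggle-exists : ∀ b → ∃ λ m → IsToggle m b
  toggle-exists b = set m , ∈⇔ m
    where
    m = union (intersection (singleton b) (complement (singleton ∅)))
              (intersection (complement (singleton b)) (singleton ∅))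

  singleton-unique : ∀ {x a a′} → IsSingleton x a → IsSingleton x a′ → a ≡ a′
  singleton-unique (a∈x , _) (_ , only-a′) = only-a′ a∈x

  cosingleton-unique : ∀ {w c c′} → IsCosingleton w c → IsCosingleton w c′ → c ≡ c′
  cosingleton-unique (c∉w , _) (_ , ≢c′→∈w) = stable (λ c≢c′ → c∉w (≢c′→∈w c≢c′))

  toggle-∈ : ∀ {m b} → IsToggle m b → b ≢ ∅ → b ∈ m
  toggle-∈ m≈b b≢∅ = from (m≈b _) (inj₁ (refl , b≢∅))

  ∅-∈-toggle : ∀ {m b} → IsToggle m b → b ≢ ∅ → ∅ ∈ m
  ∅-∈-toggle m≈b b≢∅ = from (m≈b ∅) (inj₂ ((λ ∅≡b → b≢∅ (sym ∅≡b)) , refl))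

  toggle-∈⁻ : ∀ {m b p} → IsToggle m b → p ∈ m → p ≢ ∅ → p ≡ b
  toggle-∈⁻ m≈b p∈m p≢∅ with to (m≈b _) p∈m
  ... | inj₁ (p≡b , _) = p≡b
  ... | inj₂ (_ , p≡∅) = ⊥-elim (p≢∅ p≡∅)

  toggle-unique : ∀ {m b b′} → IsToggle m b → IsToggle m b′ → b ≡ b′
  toggle-unique {b = b} {b′} m≈b m≈b′ with lem (b ≡ ∅) | lem (b′ ≡ ∅)
  ... | yes b≡∅ | yes b′≡∅ = trans b≡∅ (sym b′≡∅)
  ... | _       | no b′≢∅  = sym (toggle-∈⁻ m≈b (toggle-∈ m≈b′ b′≢∅) b′≢∅)
  ... | no b≢∅  | _        = toggle-∈⁻ m≈b′ (toggle-∈ m≈b b≢∅) b≢∅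

  singleton-small : ∀ {x} → Singleton x → Small x
  singleton-small (a , _ , only-a) = a , a , λ p∈x → inj₁ (only-a p∈x)

  pair-small : ∀ {v p q} → IsPair v p q → Small v
  pair-small v≈pq = _ , _ , pair-∈⁻ v≈pq

  toggle-small : ∀ {m} → Toggle m → Small m
  toggle-small (b , m≈b) = b , ∅ , λ p∈m → Sum.map proj₁ proj₂ (to (m≈b _) p∈m)

  small-three : ∀ {w d₁ d₂ d₃} → Small w → d₁ ≢ d₂ → d₁ ≢ d₃ → d₂ ≢ d₃ →
                d₁ ∈ w → d₂ ∈ w → d₃ ∈ w → ⊥
  small-three (_ , _ , w⊆) d₁≢d₂ d₁≢d₃ d₂≢d₃ d₁∈w d₂∈w d₃∈w
    with w⊆ d₁∈w | w⊆ d₂∈w | w⊆ d₃∈w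
  ... | inj₁ d₁≡q | inj₁ d₂≡q | _         = d₁≢d₂ (trans d₁≡q (sym d₂≡q))
  ... | inj₂ d₁≡q | inj₂ d₂≡q | _         = d₁≢d₂ (trans d₁≡q (sym d₂≡q))
  ... | inj₁ d₁≡q | inj₂ _    | inj₁ d₃≡q = d₁≢d₃ (trans d₁≡q (sym d₃≡q))
  ... | inj₁ _    | inj₂ d₂≡q | inj₂ d₃≡q = d₂≢d₃ (trans d₂≡q (sym d₃≡q))
  ... | inj₂ _    | inj₁ d₂≡q | inj₁ d₃≡q = d₂≢d₃ (trans d₂≡q (sym d₃≡q))
  ... | inj₂ d₁≡q | inj₁ _    | inj₂ d₃≡q = d₁≢d₃ (trans d₁≡q (sym d₃≡q))

  [∅] : M
  [∅] = set (singleton ∅)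

  [𝕍] : M
  [𝕍] = set (singleton 𝕍)

  ∅≢[∅] : ∅ ≢ [∅]
  ∅≢[∅] ∅≡[∅] = ∉∅ ∅ (subst (∅ ∈_) (sym ∅≡[∅]) (∈⁺ (singleton ∅) refl))

  ∅≢[𝕍] : ∅ ≢ [𝕍]
  ∅≢[𝕍] ∅≡[𝕍] = ∉∅ 𝕍 (subst (𝕍 ∈_) (sym ∅≡[𝕍]) (∈⁺ (singleton 𝕍) refl))

  𝕍≢[∅] : 𝕍 ≢ [∅]
  𝕍≢[∅] 𝕍≡[∅] = ∅≢𝕍 (sym (∈⁻ (singleton ∅) (subst (𝕍 ∈_) 𝕍≡[∅] (∈𝕍 𝕍))))

  𝕍≢[𝕍] : 𝕍 ≢ [𝕍]
  𝕍≢[𝕍] 𝕍≡[𝕍] = ∅≢𝕍 (∈⁻ (singleton 𝕍) (subst (∅ ∈_) 𝕍≡[𝕍] (∈𝕍 ∅)))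

  [∅]≢[𝕍] : [∅] ≢ [𝕍]
  [∅]≢[𝕍] [∅]≡[𝕍] = ∅≢𝕍 (∈⁻ (singleton 𝕍) (subst (∅ ∈_) [∅]≡[𝕍] (∈⁺ (singleton ∅) refl)))

  ThreeDistinctAvoiding : M → Set
  ThreeDistinctAvoiding c = ∃ λ d₁ → ∃ λ d₂ → ∃ λ d₃ →
    (d₁ ≢ d₂ × d₁ ≢ d₃ × d₂ ≢ d₃) × (d₁ ≢ c × d₂ ≢ c × d₃ ≢ c)

  ≢-via : {d₀ d c : M} → d₀ ≡ c → d₀ ≢ d → d ≢ c
  ≢-via d₀≡c d₀≢d d≡c = d₀≢d (trans d₀≡c (sym d≡c))

  -- ∅, 𝕍, {∅}, {𝕍} are four distinct objects, so at least three of them differ from c.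
  three-distinct-avoiding : ∀ c → ThreeDistinctAvoiding c
  three-distinct-avoiding c with lem (∅ ≡ c) | lem (𝕍 ≡ c) | lem ([∅] ≡ c)
  ... | yes ∅≡c | _       | _ =
    𝕍 , [∅] , [𝕍] , (𝕍≢[∅] , 𝕍≢[𝕍] , [∅]≢[𝕍]) ,
    (≢-via ∅≡c ∅≢𝕍 , ≢-via ∅≡c ∅≢[∅] , ≢-via ∅≡c ∅≢[𝕍])
  ... | no ∅≢c  | yes 𝕍≡c | _ =
    ∅ , [∅] , [𝕍] , (∅≢[∅] , ∅≢[𝕍] , [∅]≢[𝕍]) ,
    (∅≢c , ≢-via 𝕍≡c 𝕍≢[∅] , ≢-via 𝕍≡c 𝕍≢[𝕍])
  ... | no ∅≢c  | no 𝕍≢c  | yes [∅]≡c =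
    ∅ , 𝕍 , [𝕍] , (∅≢𝕍 , ∅≢[𝕍] , 𝕍≢[𝕍]) , (∅≢c , 𝕍≢c , ≢-via [∅]≡c [∅]≢[𝕍])
  ... | no ∅≢c  | no 𝕍≢c  | no [∅]≢c =
    ∅ , 𝕍 , [∅] , (∅≢𝕍 , ∅≢[∅] , 𝕍≢[∅]) , (∅≢c , 𝕍≢c , [∅]≢c)

  cosingleton-not-small : ∀ {w} → Cosingleton w → ¬ Small w
  cosingleton-not-small (c , _ , ≢c→∈w) w-small =
    let (_ , _ , _ , (d₁≢d₂ , d₁≢d₃ , d₂≢d₃) , (d₁≢c , d₂≢c , d₃≢c)) = three-distinct-avoiding c
    in small-three w-small d₁≢d₂ d₁≢d₃ d₂≢d₃ (≢c→∈w d₁≢c) (≢c→∈w d₂≢c) (≢c→∈w d₃≢c)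

  singleton⊥cosingleton : Disjoint Singleton Cosingleton
  singleton⊥cosingleton (sg , co) = cosingleton-not-small co (singleton-small sg)

  toggle⊥cosingleton : Disjoint Toggle Cosingleton
  toggle⊥cosingleton (tg , co) = cosingleton-not-small co (toggle-small tg)

  singleton⊥toggle : Disjoint Singleton Toggle
  singleton⊥toggle ((a , a∈x , only-a) , (b , x≈b)) with to (x≈b a) a∈x
  ... | inj₁ (a≡b , a≢∅) = a≢∅ (sym (only-a (∅-∈-toggle x≈b λ b≡∅ → a≢∅ (trans a≡b b≡∅))))
  ... | inj₂ (a≢b , a≡∅) = a≢b (sym (only-a (toggle-∈ x≈b λ b≡∅ → a≢b (trans a≡∅ (sym b≡∅)))))

  IsDoubleton : M → Set
  IsDoubleton v = ∃ λ p → ∃ λ q → p ≢ q × IsPair v p q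

  IsPairSet : M → Set
  IsPairSet v = ∃ λ p → ∃ λ q → IsPair v p q

  singleton⊥doubleton : Disjoint Singleton IsDoubleton
  singleton⊥doubleton (sg , (_ , _ , p≢q , v≈pq)) =
    singleton⊥plural (sg , (_ , _ , pair-∈ˡ v≈pq , pair-∈ʳ v≈pq , p≢q))

  doubleton⊥cosingleton : Disjoint IsDoubleton Cosingleton
  doubleton⊥cosingleton ((_ , _ , _ , v≈pq) , co) = cosingleton-not-small co (pair-small v≈pq)

  -- w = 𝕍 ∖ {c} iff w and {c} are complementary; excluding singletons fixes which end is w.
  cosingletons : SetOf Cosingleton
  cosingletons = SetOf-cong
    (intersection (fieldOf (restrict universe singletons complementary-sym complementaryᴿ)) (complement singletons))
    (λ { ((_ , fwd (_ , (c , c∈z , only-c) , w-z , w∪z)) , _) →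
           c , (λ c∈w → w-z (c , c∈w , c∈z))
             , (λ {p} p≢c → stable (λ p∉w → w∪z (p , p∉w , λ p∈z → p≢c (only-c p∈z))))
       ; ((_ , bwd (_ , w-singleton , _)) , ¬singleton) → ⊥-elim (¬singleton w-singleton) })
    (λ {w} (c , c∉w , ≢c→∈w) →
       (set (singleton c) , fwd (tt , (c , singleton-isSingleton c) ,
          singleton-misses′ c∉w ,
          λ (p , p∉w , p∉c) → p∉c (∈⁺ (singleton c) (stable (λ p≢c → p∉w (≢c→∈w p≢c))))))
       , λ w-singleton → singleton⊥cosingleton (w-singleton , (c , c∉w , ≢c→∈w)))
    where
    complementary-sym : Symmetric (Misses ∩ᴿ Covers)
    complementary-sym (x-z , x∪z) = misses-sym x-z , covers-sym x∪z
    complementaryᴿ : RelOf (Misses ∩ᴿ Covers)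
    complementaryᴿ = intersectˢ misses-sym covers-sym missesᴿ coversᴿ
    singleton-misses′ : ∀ {c w} → c ∉ w → Misses w (set (singleton c))
    singleton-misses′ c∉w x-c = singleton-misses c∉w (meets-sym x-c)

  pairSets : SetOf IsPairSet
  pairSets = SetOf-cong allPairs (λ (p , q , v≈pq , _) → p , q , v≈pq) (λ (p , q , v≈pq) → p , q , v≈pq , tt)

  doubletons : SetOf IsDoubleton
  doubletons = SetOf-cong (intersection pairSets plural)
    (λ ((p , q , v≈pq) , (r , s , r∈v , s∈v , r≢s)) → p , q , distinct v≈pq r∈v s∈v r≢s , v≈pq)
    (λ (p , q , p≢q , v≈pq) → (p , q , v≈pq) , (p , q , pair-∈ˡ v≈pq , pair-∈ʳ v≈pq , p≢q))
    where
    distinct : ∀ {v p q r s} → IsPair v p q → r ∈ v → s ∈ v → r ≢ s → p ≢ q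
    distinct v≈pp r∈v s∈v r≢s refl = singleton⊥plural ((_ , pair-isSingleton v≈pp) , (_ , _ , r∈v , s∈v , r≢s))

  containsEmpty : SetOf (∅ ∈_)
  containsEmpty = SetOf-cong (overlapping (singleton ∅))
    (λ {x} (p , p∈x , p≡∅) → subst (_∈ x) p≡∅ p∈x) (λ ∅∈x → ∅ , ∅∈x , refl)

  -- Relations between coded objects

  Coding : Rel M 0ℓ → Pred M 0ℓ
  Coding P x = ∃ (P x)

  Coded : Rel M 0ℓ → Rel M 0ℓ → Rel M 0ℓ → Rel M 0ℓ
  Coded P Q F x z = ∃ λ a → ∃ λ b → P x a × Q z b × F a b

  coded-⊆ : {P Q F : Rel M 0ℓ} → Coded P Q F ⊆ Coding P ⊗ Coding Q
  coded-⊆ (a , b , Pxa , Qzb , _) = (a , Pxa) , (b , Qzb)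

  mapᶜ : {P Q F G : Rel M 0ℓ} → F ⇒ G → G ⇒ F → RelOf (Coded P Q F) → RelOf (Coded P Q G)
  mapᶜ F⇒G G⇒F R = RelOf-cong R (λ (a , b , Pxa , Qzb , f) → fwd (a , b , Pxa , Qzb , F⇒G f))
                                (λ (a , b , Pxa , Qzb , g) → fwd (a , b , Pxa , Qzb , G⇒F g))

  flipᶜ : {P Q F : Rel M 0ℓ} → RelOf (Coded P Q F) → RelOf (Coded Q P (flip F))
  flipᶜ R = RelOf-cong R (λ (a , b , Pxa , Qzb , f) → bwd (b , a , Qzb , Pxa , f))
                         (λ (b , a , Qxb , Pza , f) → bwd (a , b , Pza , Qxb , f))

  composeᶜ : {P Q W F G : Rel M 0ℓ} →
             Disjoint (Coding P) (Coding Q) → Disjoint (Coding Q) (Coding W) → Disjoint (Coding P) (Coding W) →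
             (∀ {m b b′} → Q m b → Q m b′ → b ≡ b′) → (∀ b → ∃ λ m → Q m b) →
             RelOf (Coded P Q F) → RelOf (Coded Q W G) → RelOf (Coded P W (F ⨾ G))
  composeᶜ {P} {Q} {W} {F} {G} P⊥Q Q⊥W P⊥W Q-unique Q-exists R₁ R₂ =
    RelOf-cong (composeᵗ {C = Coding P} {Coding Q} {Coding W} P⊥Q Q⊥W P⊥W
                           (coded-⊆ {P} {Q} {F}) (coded-⊆ {Q} {W} {G}) R₁ R₂)
               sound complete
    where
    sound : (Coded P Q F ⨾ Coded Q W G) ⇒ SymClosure (Coded P W (F ⨾ G))
    sound (_ , (a , b , Pxa , Qmb , f) , (b′ , c , Qmb′ , Wzc , g)) with Q-unique Qmb Qmb′
    ... | refl = fwd (a , c , Pxa , Wzc , b , f , g)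
    complete : Coded P W (F ⨾ G) ⇒ SymClosure (Coded P Q F ⨾ Coded Q W G)
    complete (a , c , Pxa , Wzc , b , f , g) =
      let (m , Qmb) = Q-exists b in fwd (m , (a , b , Pxa , Qmb , f) , (b , c , Qmb , Wzc , g))

  singleton≡cosingletonᴿ : RelOf (Coded IsSingleton IsCosingleton _≡_)
  singleton≡cosingletonᴿ = RelOf-cong (restrict singletons cosingletons misses-sym missesᴿ)
    (λ ((a , x≈a) , (c , w≈c) , x-w) →
       fwd (a , c , x≈a , w≈c , stable (λ a≢c → x-w (a , proj₁ x≈a , proj₂ w≈c a≢c))))
    (λ { (a , _ , x≈a , w≈a , refl) →
       fwd ((a , x≈a) , (a , w≈a) , λ (d , d∈x , d∈w) → proj₁ w≈a (subst (_∈ _) (proj₂ x≈a d∈x) d∈w)) })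

  singleton≢cosingletonᴿ : RelOf (Coded IsSingleton IsCosingleton _≢_)
  singleton≢cosingletonᴿ = RelOf-cong (restrict singletons cosingletons meets-sym meetsᴿ)
    (λ ((a , x≈a) , (c , w≈c) , (d , d∈x , d∈w)) →
       fwd (a , c , x≈a , w≈c , λ a≡c → proj₁ w≈c (subst (_∈ _) (trans (proj₂ x≈a d∈x) a≡c) d∈w)))
    (λ (a , c , x≈a , w≈c , a≢c) → fwd ((a , x≈a) , (c , w≈c) , (a , proj₁ x≈a , proj₂ w≈c a≢c)))

  DiffersOff∅ : Rel M 0ℓ
  DiffersOff∅ x m = ∃ λ p → p ≢ ∅ × (p ∈ x ⊻ p ∈ m)

  ⊻-swap : {A B : Set} → A ⊻ B → B ⊻ A
  ⊻-swap (inj₁ (a , ¬b)) = inj₂ (¬b , a)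
  ⊻-swap (inj₂ (¬a , b)) = inj₁ (b , ¬a)

  differs-sym : Symmetric DiffersOff∅
  differs-sym (p , p≢∅ , p∈x⊻p∈m) = p , p≢∅ , ⊻-swap p∈x⊻p∈m

  -- x and m differ at some p ≠ ∅ iff some s ∌ ∅ meets one and misses the other (take s = {p}).
  differsᴿ : RelOf DiffersOff∅
  differsᴿ = RelOf-cong (composeᴿ probeᴿ missesᴿ) sound complete
    where
    Probe : Rel M 0ℓ
    Probe = Restrict U (∅ ∉_) Meets
    probeᴿ : RelOf Probe
    probeᴿ = restrict universe (complement containsEmpty) meets-sym meetsᴿ
    witness : ∀ {s m p} → SymClosure Misses s m → p ∈ s → p ∉ m
    witness s-m p∈s p∈m = symClosure-elim misses-sym s-m (_ , p∈s , p∈m)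
    off∅ : ∀ {s p} → ∅ ∉ s → p ∈ s → p ≢ ∅
    off∅ ∅∉s p∈s p≡∅ = ∅∉s (subst (_∈ _) p≡∅ p∈s)
    sound : (SymClosure Probe ⨾ SymClosure Misses) ⇒ SymClosure DiffersOff∅
    sound (_ , fwd (_ , ∅∉s , (p , p∈x , p∈s)) , s-m) = fwd (p , off∅ ∅∉s p∈s , inj₁ (p∈x , witness s-m p∈s))
    sound (_ , bwd (_ , ∅∉x , (p , p∈s , p∈x)) , s-m) = fwd (p , off∅ ∅∉x p∈x , inj₁ (p∈x , witness s-m p∈s))
    probe : ∀ {x p} → p ≢ ∅ → p ∈ x → Probe x (set (singleton p))
    probe p≢∅ p∈x =
      tt , (λ ∅∈sp → p≢∅ (sym (∈⁻ (singleton _) ∅∈sp))) , (_ , p∈x , ∈⁺ (singleton _) refl)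
    complete : DiffersOff∅ ⇒ SymClosure (SymClosure Probe ⨾ SymClosure Misses)
    complete (p , p≢∅ , inj₁ (p∈x , p∉m)) = fwd (_ , fwd (probe p≢∅ p∈x) , fwd (singleton-misses p∉m))
    complete (p , p≢∅ , inj₂ (p∉x , p∈m)) = bwd (_ , fwd (probe p≢∅ p∈m) , fwd (singleton-misses p∉x))

  -- {b} and {b} △ {∅} agree away from ∅ and disagree at ∅.
  Agreeing : Rel M 0ℓ
  Agreeing x m = ¬ DiffersOff∅ x m × (∅ ∈ x ⊻ ∅ ∈ m)

  toggle-of-agreeing : ∀ {s m b} → IsSingleton s b → Agreeing s m → IsToggle m b
  toggle-of-agreeing {s} {m} {b} s≈b (agree , parity) p = mk⇔ into outof
    where
    into : p ∈ m → p ≡ b ⊻ p ≡ ∅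
    into p∈m with lem (p ≡ ∅)
    ... | yes refl = Sum.[ (λ (_ , ∅∉m) → ⊥-elim (∅∉m p∈m))
                         , (λ (∅∉s , _) → inj₂ ((λ ∅≡b → ∅∉s (subst (_∈ s) (sym ∅≡b) (proj₁ s≈b))) , refl))
                         ] parity
    ... | no p≢∅   = inj₁ (proj₂ s≈b (stable (λ p∉s → agree (p , p≢∅ , inj₂ (p∉s , p∈m)))) , p≢∅)
    outof : p ≡ b ⊻ p ≡ ∅ → p ∈ m
    outof (inj₁ (p≡b , p≢∅)) =
      stable (λ p∉m → agree (p , p≢∅ , inj₁ (subst (_∈ s) (sym p≡b) (proj₁ s≈b) , p∉m)))
    outof (inj₂ (p≢b , refl)) =
      Sum.[ (λ (∅∈s , _) → ⊥-elim (p≢b (proj₂ s≈b ∅∈s))) , (λ (_ , ∅∈m) → ∅∈m) ] parity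

  agreeing-of-toggle : ∀ {s m b} → IsSingleton s b → IsToggle m b → Agreeing s m
  agreeing-of-toggle {s} {m} {b} s≈b m≈b = agree , parity
    where
    agree : ¬ DiffersOff∅ s m
    agree (p , p≢∅ , inj₁ (p∈s , p∉m)) with proj₂ s≈b p∈s
    ... | refl = p∉m (toggle-∈ m≈b p≢∅)
    agree (p , p≢∅ , inj₂ (p∉s , p∈m)) = p∉s (subst (_∈ s) (sym (toggle-∈⁻ m≈b p∈m p≢∅)) (proj₁ s≈b))
    parity : ∅ ∈ s ⊻ ∅ ∈ m
    parity with lem (b ≡ ∅)
    ... | yes refl = inj₁ (proj₁ s≈b , λ ∅∈m →
                       Sum.[ (λ (_ , ∅≢∅) → ∅≢∅ refl) , (λ (∅≢∅ , _) → ∅≢∅ refl) ] (to (m≈b ∅) ∅∈m))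
    ... | no b≢∅   = inj₂ ((λ ∅∈s → b≢∅ (sym (proj₂ s≈b ∅∈s))) , ∅-∈-toggle m≈b b≢∅)

  singleton≡toggleᴿ : RelOf (Coded IsSingleton IsToggle _≡_)
  singleton≡toggleᴿ = RelOf-cong (restrict singletons universe agreeing-sym agreeingᴿ)
    (λ ((b , s≈b) , _ , s~m) → fwd (b , b , s≈b , toggle-of-agreeing s≈b s~m , refl))
    (λ { (b , _ , s≈b , m≈b , refl) → fwd ((b , s≈b) , tt , agreeing-of-toggle s≈b m≈b) })
    where
    nondiffering-sym : Symmetric (λ x m → ¬ DiffersOff∅ x m)
    nondiffering-sym ¬d d = ¬d (differs-sym d)
    agreeing-sym : Symmetric Agreeing
    agreeing-sym (agree , parity) = nondiffering-sym agree , ⊻-swap parity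
    agreeingᴿ : RelOf Agreeing
    agreeingᴿ = RelOf-cong
      (intersectᴿ (complementˢ differs-sym differsᴿ) (rectangle containsEmpty (complement containsEmpty)))
      (λ { (agree , fwd (∅∈x , ∅∉m)) → fwd (symClosure-elim nondiffering-sym agree , inj₁ (∅∈x , ∅∉m))
         ; (agree , bwd (∅∈m , ∅∉x)) → fwd (symClosure-elim nondiffering-sym agree , inj₂ (∅∉x , ∅∈m)) })
      (λ { (agree , inj₁ (∅∈x , ∅∉m)) → fwd (fwd agree , fwd (∅∈x , ∅∉m))
         ; (agree , inj₂ (∅∉x , ∅∈m)) → fwd (fwd agree , bwd (∅∈m , ∅∉x)) })

  -- Kuratowski pairs

  IsKP : M → M → M → Set
  IsKP = kp 𝔐

  KPair : Pred M 0ℓ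
  KPair y = ∃ λ a → ∃ λ b → IsKP y a b

  DiagonalKPair : Pred M 0ℓ
  DiagonalKPair y = ∃ λ a → IsKP y a a

  kpairs : SetOf KPair
  kpairs = SetOf-cong (restrict singletons pairSets meets-sym meetsᴿ) sound complete
    where
    sound : Edge (Restrict Singleton IsPairSet Meets) ⊆ KPair
    sound (u , v , y≈uv , (a , u≈a) , (p , q , v≈pq) , (c , c∈u , c∈v))
      with pair-∈⁻ v≈pq (subst (_∈ v) (proj₂ u≈a c∈u) c∈v)
    ... | inj₁ refl = a , q , u , v , y≈uv , isSingleton-pair u≈a , v≈pq
    ... | inj₂ refl = a , p , u , v , y≈uv , isSingleton-pair u≈a , pair-sym v≈pq
    complete : KPair ⊆ Edge (Restrict Singleton IsPairSet Meets)
    complete (a , b , u , v , y≈uv , u≈aa , v≈ab) =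
      u , v , y≈uv , (a , pair-isSingleton u≈aa) , (a , b , v≈ab) , (a , pair-∈ˡ u≈aa , pair-∈ˡ v≈ab)

  diagonalKPairs : SetOf DiagonalKPair
  diagonalKPairs = SetOf-cong (intersection kpairs (rectangle singletons singletons)) sound complete
    where
    sound : KPair ∩ Edge (λ x z → Singleton x × Singleton z) ⊆ DiagonalKPair
    sound ((a , b , u , v , y≈uv , u≈aa , v≈ab) , (x , z , y≈xz , x-sg , z-sg)) =
      a , subst (IsKP _ a) (trans (only-d (pair-∈ʳ v≈ab)) (sym (only-d (pair-∈ˡ v≈ab))))
                (u , v , y≈uv , u≈aa , v≈ab)
      where
      v-singleton : Singleton v
      v-singleton = Sum.[ (λ v≡x → subst Singleton (sym v≡x) x-sg) , (λ v≡z → subst Singleton (sym v≡z) z-sg) ]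
                          (pair-∈⁻ y≈xz (pair-∈ʳ y≈uv))
      only-d : ∀ {p} → p ∈ v → p ≡ proj₁ v-singleton
      only-d = proj₂ (proj₂ v-singleton)
    complete : DiagonalKPair ⊆ KPair ∩ Edge (λ x z → Singleton x × Singleton z)
    complete (a , u , v , y≈uv , u≈aa , v≈aa) =
      (a , a , u , v , y≈uv , u≈aa , v≈aa) ,
      (u , v , y≈uv , (a , pair-isSingleton u≈aa) , (a , pair-isSingleton v≈aa))

  kpair-member-small : ∀ {y w} → KPair y → w ∈ y → Small w
  kpair-member-small (_ , _ , _ , _ , y≈uv , u≈aa , v≈ab) w∈y with pair-∈⁻ y≈uv w∈y
  ... | inj₁ refl = pair-small u≈aa
  ... | inj₂ refl = pair-small v≈ab

  -- κ = {{a, b}, 𝕍 ∖ {b}} ties the second Kuratowski component to the code of b.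
  BridgeLink : Rel M 0ℓ
  BridgeLink v w = IsDoubleton v × ∃ λ c → IsCosingleton w c × c ∈ v

  Bridge : Pred M 0ℓ
  Bridge = Edge BridgeLink

  bridges : RelOf BridgeLink
  bridges = RelOf-cong
    (composeᵗ {C = IsDoubleton} {Singleton} {Cosingleton}
              (Disjoint-sym {x = Singleton} singleton⊥doubleton) singleton⊥cosingleton doubleton⊥cosingleton
              (restrict-⊆ {IsDoubleton} {Singleton} {Meets}) (coded-⊆ {IsSingleton} {IsCosingleton} {_≡_})
              (restrict doubletons singletons meets-sym meetsᴿ) singleton≡cosingletonᴿ)
    (λ (_ , (v-dbl , _ , (d , d∈v , d∈s)) , (a , c , s≈a , w≈c , a≡c)) →
       fwd (v-dbl , c , w≈c , subst (_∈ _) (trans (proj₂ s≈a d∈s) a≡c) d∈v))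
    (λ (v-dbl , c , w≈c , c∈v) →
       fwd (set (singleton c) , (v-dbl , (c , singleton-isSingleton c) , (c , c∈v , ∈⁺ (singleton c) refl))
                              , (c , c , singleton-isSingleton c , w≈c , refl)))

  CodeEdge : Rel M 0ℓ → Pred M 0ℓ
  CodeEdge F = Edge (Coded IsSingleton IsCosingleton F)

  codeEdges : SetOf (CodeEdge (λ _ _ → ⊤))
  codeEdges = RelOf-cong (rectangle singletons cosingletons)
    (λ ((a , x≈a) , (b , w≈b)) → fwd (a , b , x≈a , w≈b , tt))
    (λ (a , b , x≈a , w≈b , _) → fwd ((a , x≈a) , (b , w≈b)))

  codeEdge⊥kpair : {F : Rel M 0ℓ} → Disjoint (CodeEdge F) KPair
  codeEdge⊥kpair ((_ , w , t≈sw , _ , b , _ , w≈b , _) , kpair) =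
    cosingleton-not-small (b , w≈b) (kpair-member-small kpair (pair-∈ʳ t≈sw))

  bridge⊥kpair : Disjoint Bridge KPair
  bridge⊥kpair ((_ , w , κ≈vw , _ , c , w≈c , _) , kpair) =
    cosingleton-not-small (c , w≈c) (kpair-member-small kpair (pair-∈ʳ κ≈vw))

  codeEdge⊥bridge : {F : Rel M 0ℓ} → Disjoint (CodeEdge F) Bridge
  codeEdge⊥bridge ((s , w , t≈sw , a , b , s≈a , w≈b , _) , (v , _ , t≈vw′ , v-dbl , _))
    with pair-∈⁻ t≈sw (pair-∈ˡ t≈vw′)
  ... | inj₁ refl = singleton⊥doubleton ((a , s≈a) , v-dbl)
  ... | inj₂ refl = doubleton⊥cosingleton (v-dbl , (b , w≈b))

  meets-pairs : ∀ {t k x₁ x₂ y₁ y₂} → IsPair t x₁ x₂ → IsPair k y₁ y₂ → Meets t k →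
                (x₁ ≡ y₁ ⊎ x₁ ≡ y₂) ⊎ (x₂ ≡ y₁ ⊎ x₂ ≡ y₂)
  meets-pairs t≈ k≈ (_ , e∈t , e∈k) with pair-∈⁻ t≈ e∈t | pair-∈⁻ k≈ e∈k
  ... | inj₁ refl | inj₁ refl = inj₁ (inj₁ refl)
  ... | inj₁ refl | inj₂ refl = inj₁ (inj₂ refl)
  ... | inj₂ refl | inj₁ refl = inj₂ (inj₁ refl)
  ... | inj₂ refl | inj₂ refl = inj₂ (inj₂ refl)

  codeEdge-meets-bridge : ∀ {t κ s w v′ w′} → IsPair t s w → Singleton s → Cosingleton w →
                          IsPair κ v′ w′ → IsDoubleton v′ → Cosingleton w′ → Meets t κ → w ≡ w′
  codeEdge-meets-bridge t≈sw s-sg w-co κ≈ v′-dbl w′-co t~κ with meets-pairs t≈sw κ≈ t~κ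
  ... | inj₁ (inj₁ refl) = ⊥-elim (singleton⊥doubleton (s-sg , v′-dbl))
  ... | inj₁ (inj₂ refl) = ⊥-elim (singleton⊥cosingleton (s-sg , w′-co))
  ... | inj₂ (inj₁ refl) = ⊥-elim (doubleton⊥cosingleton (v′-dbl , w-co))
  ... | inj₂ (inj₂ w≡w′) = w≡w′

  bridge-meets-kpair : ∀ {κ k v′ w′ u v a b} → IsPair κ v′ w′ → IsDoubleton v′ → Cosingleton w′ →
                       IsPair k u v → IsPair u a a → IsPair v a b → Meets κ k → v′ ≡ v
  bridge-meets-kpair κ≈ v′-dbl w′-co k≈uv u≈aa v≈ab κ~k with meets-pairs κ≈ k≈uv κ~k
  ... | inj₁ (inj₁ refl) = ⊥-elim (singleton⊥doubleton ((_ , pair-isSingleton u≈aa) , v′-dbl))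
  ... | inj₁ (inj₂ v′≡v) = v′≡v
  ... | inj₂ (inj₁ refl) = ⊥-elim (cosingleton-not-small w′-co (pair-small u≈aa))
  ... | inj₂ (inj₂ refl) = ⊥-elim (cosingleton-not-small w′-co (pair-small v≈ab))

  codeEdge-meets-kpair : ∀ {t k s w u v a b} → IsPair t s w → Cosingleton w →
                         IsPair k u v → IsPair u a a → IsPair v a b → Meets t k → s ≡ u ⊎ s ≡ v
  codeEdge-meets-kpair t≈sw w-co k≈uv u≈aa v≈ab t~k with meets-pairs t≈sw k≈uv t~k
  ... | inj₁ s≡u⊎s≡v   = s≡u⊎s≡v
  ... | inj₂ (inj₁ refl) = ⊥-elim (cosingleton-not-small w-co (pair-small u≈aa))
  ... | inj₂ (inj₂ refl) = ⊥-elim (cosingleton-not-small w-co (pair-small v≈ab))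

  -- t = {u, 𝕍 ∖ {b}} shares its member u = {a} with the Kuratowski pair k = {u, {a, b}}.
  Encodes : Rel M 0ℓ
  Encodes t k = ∃ λ u → ∃ λ v → ∃ λ w → ∃ λ a → ∃ λ b →
    IsPair k u v × IsPair u a a × IsPair v a b × IsPair t u w × IsCosingleton w b

  encodes-⊆ : Encodes ⊆ CodeEdge (λ _ _ → ⊤) ⊗ KPair
  encodes-⊆ (u , v , w , a , b , k≈uv , u≈aa , v≈ab , t≈uw , w≈b) =
    (u , w , t≈uw , a , b , pair-isSingleton u≈aa , w≈b , tt) , (a , b , u , v , k≈uv , u≈aa , v≈ab)

  Via : Pred M 0ℓ → Rel M 0ℓ → Rel M 0ℓ
  Via E Q x z = ∃ λ m → E m × Q x m × Q m z

  -- Meeting k identifies a; for a ≠ b a bridge identifies b, while for a = b no bridge is needed.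
  EncodesDistinct : Rel M 0ℓ
  EncodesDistinct = Restrict (CodeEdge _≢_) KPair (Meets ∩ᴿ Via Bridge Meets)

  EncodesDiagonal : Rel M 0ℓ
  EncodesDiagonal = Restrict (CodeEdge _≡_) DiagonalKPair Meets

  encodesDistinctᴿ : RelOf EncodesDistinct
  encodesDistinctᴿ = RelOf-cong
    (intersectᵗ {A = Direct} {B = Path} codeEdge⊥kpair (restrict-⊆ {CodeEdge _≢_} {KPair} {Meets}) path-⊆
                directᴿ pathᴿ)
    (λ ((sc , kpair , t~k) , (κ , (_ , bridge , t~κ) , (_ , _ , κ~k))) →
       fwd (sc , kpair , t~k , κ , bridge , t~κ , κ~k))
    (λ (sc , kpair , t~k , κ , bridge , t~κ , κ~k) →
       fwd ((sc , kpair , t~k) , (κ , (sc , bridge , t~κ) , (bridge , kpair , κ~k))))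
    where
    Direct : Rel M 0ℓ
    Direct = Restrict (CodeEdge _≢_) KPair Meets
    ToBridge : Rel M 0ℓ
    ToBridge = Restrict (CodeEdge _≢_) Bridge Meets
    FromBridge : Rel M 0ℓ
    FromBridge = Restrict Bridge KPair Meets
    Path : Rel M 0ℓ
    Path = ToBridge ⨾ FromBridge
    directᴿ : RelOf Direct
    directᴿ = restrict singleton≢cosingletonᴿ kpairs meets-sym meetsᴿ
    pathᴿ : RelOf Path
    pathᴿ = composeᵗ {A = ToBridge} {B = FromBridge} codeEdge⊥bridge bridge⊥kpair codeEdge⊥kpair
                     (restrict-⊆ {CodeEdge _≢_} {Bridge} {Meets}) (restrict-⊆ {Bridge} {KPair} {Meets})
                     (restrict singleton≢cosingletonᴿ bridges meets-sym meetsᴿ) (restrict bridges kpairs meets-sym meetsᴿ)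
    path-⊆ : Path ⊆ CodeEdge _≢_ ⊗ KPair
    path-⊆ (_ , (sc , _ , _) , (_ , kpair , _)) = sc , kpair

  encodesDiagonalᴿ : RelOf EncodesDiagonal
  encodesDiagonalᴿ = restrict singleton≡cosingletonᴿ diagonalKPairs meets-sym meetsᴿ

  encodes-distinct : EncodesDistinct ⇒ Encodes
  encodes-distinct ((s , w , t≈sw , a , b , s≈a , w≈b , a≢b) , (a′ , b′ , u , v , k≈uv , u≈a′ , v≈a′b′) ,
                    t~k , _ , (v″ , w″ , κ≈ , v″-dbl , c , w″≈c , c∈v″) , t~κ , κ~k)
    with codeEdge-meets-bridge t≈sw (a , s≈a) (b , w≈b) κ≈ v″-dbl (c , w″≈c) t~κ
       | bridge-meets-kpair κ≈ v″-dbl (c , w″≈c) k≈uv u≈a′ v≈a′b′ κ~k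
       | codeEdge-meets-kpair t≈sw (b , w≈b) k≈uv u≈a′ v≈a′b′ t~k
  ... | refl | refl | inj₂ refl = ⊥-elim (singleton⊥doubleton ((a , s≈a) , v″-dbl))
  ... | refl | refl | inj₁ refl
    with singleton-unique s≈a (pair-isSingleton u≈a′) | cosingleton-unique w≈b w″≈c | pair-∈⁻ v≈a′b′ c∈v″
  ...   | refl | refl | inj₁ refl = ⊥-elim (a≢b refl)
  ...   | refl | refl | inj₂ refl = s , v , w , a , b , k≈uv , u≈a′ , v≈a′b′ , t≈sw , w≈b

  encodes-diagonal : EncodesDiagonal ⇒ Encodes
  encodes-diagonal ((s , w , t≈sw , a , _ , s≈a , w≈a , refl) , (d , u , v , k≈uv , u≈dd , v≈dd) , t~k)
    with codeEdge-meets-kpair t≈sw (a , w≈a) k≈uv u≈dd v≈dd t~k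
  ... | inj₁ refl with singleton-unique s≈a (pair-isSingleton u≈dd)
  ...   | refl = s , v , w , a , a , k≈uv , u≈dd , v≈dd , t≈sw , w≈a
  encodes-diagonal ((s , w , t≈sw , a , _ , s≈a , w≈a , refl) , (d , u , v , k≈uv , u≈dd , v≈dd) , t~k)
      | inj₂ refl with singleton-unique s≈a (pair-isSingleton v≈dd)
  ...   | refl = s , u , w , a , a , pair-sym k≈uv , v≈dd , u≈dd , t≈sw , w≈a

  encodes-split : Encodes ⇒ EncodesDistinct ∪ᴿ EncodesDiagonal
  encodes-split (u , v , w , a , b , k≈uv , u≈aa , v≈ab , t≈uw , w≈b) with lem (a ≡ b)
  ... | yes refl = inj₂ ((u , w , t≈uw , a , a , pair-isSingleton u≈aa , w≈b , refl) ,
                         (a , u , v , k≈uv , u≈aa , v≈ab) , shared-u)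
    where shared-u = u , pair-∈ˡ t≈uw , pair-∈ˡ k≈uv
  ... | no a≢b = inj₁ ((u , w , t≈uw , a , b , pair-isSingleton u≈aa , w≈b , a≢b) ,
                       (a , b , u , v , k≈uv , u≈aa , v≈ab) ,
                       (u , pair-∈ˡ t≈uw , pair-∈ˡ k≈uv) ,
                       κ , (v , w , κ≈vw , (a , b , a≢b , v≈ab) , b , w≈b , pair-∈ʳ v≈ab) ,
                       (w , pair-∈ʳ t≈uw , pair-∈ʳ κ≈vw) , (v , pair-∈ˡ κ≈vw , pair-∈ʳ k≈uv))
    where
    κ = proj₁ (pair-exists v w)
    κ≈vw = proj₂ (pair-exists v w)

  encodesᴿ : RelOf Encodes
  encodesᴿ = RelOf-cong (uniteᴿ encodesDistinctᴿ encodesDiagonalᴿ)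
    (λ { (inj₁ e) → fwd (encodes-distinct e) ; (inj₂ e) → fwd (encodes-diagonal e) })
    (λ e → fwd (encodes-split e))

  EncodesWithin : Pred M 0ℓ → Pred M 0ℓ → Rel M 0ℓ
  EncodesWithin C D t k = Encodes t k × C t × D k

  encodesWithin-⊆ : {C D : Pred M 0ℓ} → EncodesWithin C D ⊆ CodeEdge (λ _ _ → ⊤) ⊗ KPair
  encodesWithin-⊆ (e , _) = encodes-⊆ e

  encodesWithin : {C D : Pred M 0ℓ} → SetOf C → SetOf D → RelOf (EncodesWithin C D)
  encodesWithin {C} {D} SC SD = RelOf-cong
    (intersectᵗ {A = Encodes} {B = Within} codeEdge⊥kpair encodes-⊆ (λ ((sc , _) , (kp , _) , _) → sc , kp) encodesᴿ
                (restrict (intersection codeEdges SC) (intersection kpairs SD) (λ _ → tt) allPairs))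
    (λ (e , (_ , c) , (_ , d) , _) → fwd (e , c , d))
    (λ (e , c , d) → fwd (e , (proj₁ (encodes-⊆ e) , c) , (proj₂ (encodes-⊆ e) , d) , tt))
    where
    Within : Rel M 0ℓ
    Within = Restrict (CodeEdge (λ _ _ → ⊤) ∩ C) (KPair ∩ D) (λ _ _ → ⊤)

  record Extensional (P : Rel M 0ℓ) : Set where
    field
      resp  : ∀ {x x′ a} → Coextensive x x′ → P x a → P x′ a
      coext : ∀ {x x′ a} → P x a → P x′ a → Coextensive x x′

  open Extensional

  singleton-extensional : Extensional IsSingleton
  singleton-extensional .resp (x⊑x′ , x′⊑x) (a∈x , only-a) = x⊑x′ a∈x , λ p∈x′ → only-a (x′⊑x p∈x′)
  singleton-extensional .coext (a∈x , only-a) (a∈x′ , only-a′) =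
    (λ p∈x → subst (_∈ _) (sym (only-a p∈x)) a∈x′) , (λ p∈x′ → subst (_∈ _) (sym (only-a′ p∈x′)) a∈x)

  cosingleton-extensional : Extensional IsCosingleton
  cosingleton-extensional .resp (x⊑x′ , x′⊑x) (c∉x , ≢c→∈x) =
    (λ c∈x′ → c∉x (x′⊑x c∈x′)) , λ p≢c → x⊑x′ (≢c→∈x p≢c)
  cosingleton-extensional .coext (c∉x , ≢c→∈x) (c∉x′ , ≢c→∈x′) =
    (λ p∈x → ≢c→∈x′ (λ p≡c → c∉x (subst (_∈ _) p≡c p∈x))) ,
    (λ p∈x′ → ≢c→∈x (λ p≡c → c∉x′ (subst (_∈ _) p≡c p∈x′)))

  -- Without Extensionality an object has many coextensive codes, but composition only joins edges
  -- through one and the same set; saturation adds every coextensive variant of each edge.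
  saturate : {P Q F A : Rel M 0ℓ} → Extensional P → Extensional Q → A ⇒ Coded P Q F →
             (∀ {a b} → F a b → ∃ λ x → ∃ λ z → P x a × Q z b × A x z) → RelOf A → RelOf (Coded P Q F)
  saturate {P} {Q} {F} {A} P-ext Q-ext A⇒coded generate R =
    RelOf-cong (composeᴿ (composeᴿ coextensiveᴿ R) coextensiveᴿ) sound complete
    where
    coextensive : SymClosure Coextensive ⇒ Coextensive
    coextensive = symClosure-elim coextensive-sym
    transportˡ : ∀ {x x′ z} → Coextensive x x′ → SymClosure (Coded P Q F) x z → SymClosure (Coded P Q F) x′ z
    transportˡ x≅x′ (fwd (a , b , Pxa , Qzb , f)) = fwd (a , b , resp P-ext x≅x′ Pxa , Qzb , f)
    transportˡ x≅x′ (bwd (a , b , Pza , Qxb , f)) = bwd (a , b , Pza , resp Q-ext x≅x′ Qxb , f)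
    transportʳ : ∀ {x z z′} → Coextensive z z′ → SymClosure (Coded P Q F) x z → SymClosure (Coded P Q F) x z′
    transportʳ z≅z′ h = symClosure-sym _ (transportˡ z≅z′ (symClosure-sym _ h))
    inner : (SymClosure Coextensive ⨾ SymClosure A) ⇒ SymClosure (Coded P Q F)
    inner (_ , x≅n , n-m) = transportˡ (coextensive-sym (coextensive x≅n)) (symClosure-map A⇒coded n-m)
    sound : (SymClosure (SymClosure Coextensive ⨾ SymClosure A) ⨾ SymClosure Coextensive) ⇒ SymClosure (Coded P Q F)
    sound (_ , x-m , m≅z) = transportʳ (coextensive m≅z) (fold (symClosure-sym _) inner x-m)
    complete : Coded P Q F ⇒ SymClosure (SymClosure (SymClosure Coextensive ⨾ SymClosure A) ⨾ SymClosure Coextensive)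
    complete (_ , _ , Pxa , Qzb , f) =
      let (x′ , z′ , Px′a , Qz′b , a) = generate f
      in fwd (z′ , fwd (x′ , fwd (coext P-ext Pxa Px′a) , fwd a) , fwd (coext Q-ext Qz′b Qzb))

  InKP : M → Rel M 0ℓ
  InKP K a b = ∃ λ k → k ∈ K × IsKP k a b

  kuratowski→coded : (K : M) → RelOf (Coded IsSingleton IsCosingleton (InKP K))
  kuratowski→coded K = saturate singleton-extensional cosingleton-extensional endpoints generate kEdgesᴿ
    where
    KEdge : Rel M 0ℓ
    KEdge s w = ∃ λ k → k ∈ K × ∃ λ v → ∃ λ a → ∃ λ b →
      IsPair k s v × IsPair s a a × IsPair v a b × IsCosingleton w b
    kEdgesᴿ : RelOf KEdge
    kEdgesᴿ = SetOf-cong (domainᵗ {A = EncodesWithin U (_∈ K)} codeEdge⊥kpair (encodesWithin-⊆ {U} {_∈ K}) codeEdges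
                                (encodesWithin universe (members K)))
      (λ (k , (u , v , w , a , b , k≈uv , u≈aa , v≈ab , t≈uw , w≈b) , _ , k∈K) →
         u , w , t≈uw , k , k∈K , v , a , b , k≈uv , u≈aa , v≈ab , w≈b)
      (λ (s , w , t≈sw , k , k∈K , v , a , b , k≈sv , s≈aa , v≈ab , w≈b) →
         k , (s , v , w , a , b , k≈sv , s≈aa , v≈ab , t≈sw , w≈b) , tt , k∈K)
    endpoints : KEdge ⇒ Coded IsSingleton IsCosingleton (InKP K)
    endpoints (k , k∈K , v , a , b , k≈sv , s≈aa , v≈ab , w≈b) =
      a , b , pair-isSingleton s≈aa , w≈b , k , k∈K , (_ , v , k≈sv , s≈aa , v≈ab)
    generate : ∀ {a b} → InKP K a b → ∃ λ x → ∃ λ z → IsSingleton x a × IsCosingleton z b × KEdge x z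
    generate {a} {b} (k , k∈K , (u , v , k≈uv , u≈aa , v≈ab)) =
      let (w , w≈b) = cosingleton-exists b
      in u , w , pair-isSingleton u≈aa , w≈b , k , k∈K , v , a , b , k≈uv , u≈aa , v≈ab , w≈b

  codeEdge-label : ∀ {F t u w a b} → IsPair t u w → IsSingleton u a → IsCosingleton w b → CodeEdge F t → F a b
  codeEdge-label {F} t≈uw u≈a w≈b (_ , _ , t≈sw′ , a′ , b′ , s≈a′ , w′≈b′ , f)
    with pair-injective t≈uw t≈sw′
  ... | inj₁ (refl , refl) = subst₂ F (singleton-unique s≈a′ u≈a) (cosingleton-unique w′≈b′ w≈b) f
  ... | inj₂ (refl , refl) = ⊥-elim (singleton⊥cosingleton ((a′ , s≈a′) , (_ , w≈b)))

  coded→kuratowski : {F : Rel M 0ℓ} → RelOf (Coded IsSingleton IsCosingleton F) →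
                     SetOf (λ y → ∃ λ a → ∃ λ c → IsKP y a c × F a c)
  coded→kuratowski {F} X = SetOf-cong
    (domainᵗ {A = flip (EncodesWithin (CodeEdge F) U)} (Disjoint-sym {x = CodeEdge (λ _ _ → ⊤)} codeEdge⊥kpair)
             (λ e → let (sc , kp) = encodesWithin-⊆ {CodeEdge F} {U} e in kp , sc)
             kpairs (flipᴿ (encodesWithin X universe)))
    (λ (t , (u , v , w , a , b , y≈uv , u≈aa , v≈ab , t≈uw , w≈b) , t∈X , _) →
       a , b , (u , v , y≈uv , u≈aa , v≈ab) , codeEdge-label t≈uw (pair-isSingleton u≈aa) w≈b t∈X)
    (λ (a , c , (u , v , y≈uv , u≈aa , v≈ac) , f) →
       let (w , w≈c) = cosingleton-exists c
           (t , t≈uw) = pair-exists u w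
       in t , (u , v , w , a , c , y≈uv , u≈aa , v≈ac , t≈uw , w≈c) ,
          (u , w , t≈uw , a , c , pair-isSingleton u≈aa , w≈c , f) , tt)

  orderedRelativeProduct : (R S : M) → SetOf (λ y → Σ M λ a → Σ M λ b → Σ M λ c → Σ M λ r → Σ M λ s →
                                                    IsKP y a c × r ∈ R × IsKP r a b × s ∈ S × IsKP s b c)
  orderedRelativeProduct R S = SetOf-cong
    (coded→kuratowski (composeᶜ {IsSingleton} {IsToggle} {IsCosingleton} {InKP R} {InKP S}
                                singleton⊥toggle toggle⊥cosingleton singleton⊥cosingleton
                                toggle-unique toggle-exists throughR throughS))
    (λ (a , c , y≈ac , b , (r , r∈R , r≈ab) , (s , s∈S , s≈bc)) →
       a , b , c , r , s , y≈ac , r∈R , r≈ab , s∈S , s≈bc)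
    (λ (a , b , c , r , s , y≈ac , r∈R , r≈ab , s∈S , s≈bc) →
       a , c , y≈ac , b , (r , r∈R , r≈ab) , (s , s∈S , s≈bc))
    where
    cosingleton≡toggleᴿ : RelOf (Coded IsCosingleton IsToggle _≡_)
    cosingleton≡toggleᴿ = mapᶜ {F = flip _≡_ ⨾ _≡_} (λ (_ , b≡a , b≡c) → trans (sym b≡a) b≡c)
                                                    (λ a≡c → _ , refl , a≡c)
      (composeᶜ {IsCosingleton} {IsSingleton} {IsToggle} {flip _≡_} {_≡_}
                (Disjoint-sym {x = Singleton} singleton⊥cosingleton) singleton⊥toggle
                (Disjoint-sym {x = Toggle} toggle⊥cosingleton)
                singleton-unique singleton-exists (flipᶜ singleton≡cosingletonᴿ) singleton≡toggleᴿ)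
    throughR : RelOf (Coded IsSingleton IsToggle (InKP R))
    throughR = mapᶜ {F = InKP R ⨾ _≡_} (λ { (_ , r , refl) → r }) (λ r → _ , r , refl)
      (composeᶜ {IsSingleton} {IsCosingleton} {IsToggle} {InKP R} {_≡_}
                singleton⊥cosingleton (Disjoint-sym {x = Toggle} toggle⊥cosingleton) singleton⊥toggle
                cosingleton-unique cosingleton-exists (kuratowski→coded R) cosingleton≡toggleᴿ)
    throughS : RelOf (Coded IsToggle IsCosingleton (InKP S))
    throughS = mapᶜ {F = flip _≡_ ⨾ InKP S} (λ { (_ , refl , s) → s }) (λ s → _ , refl , s)
      (composeᶜ {IsToggle} {IsSingleton} {IsCosingleton} {flip _≡_} {InKP S}
                (Disjoint-sym {x = Singleton} singleton⊥toggle) singleton⊥cosingleton toggle⊥cosingleton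
                singleton-unique singleton-exists (flipᶜ singleton≡toggleᴿ) (kuratowski→coded S))

mainTheorem3 : LEM → (𝔐 : Structure) →
    ShefferAx 𝔐 → SingletonAx 𝔐 → UnionAx 𝔐 →
    UnorderedRelProdAx 𝔐 → UnorderedIntersectionRelAx 𝔐 →
    OrderedRelProd 𝔐
mainTheorem3 lem 𝔐 sheffer singleton union product meets R S = set X , ∈⇔ X
  where
  open Construction lem 𝔐 sheffer singleton union product meets R
  X = orderedRelativeProduct R S
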